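{- Let $\mathcal{K}=(\mathcal{O},\mathcal{P})$ be a DL-safe hybrid knowledge base with function symbols, and let $\mathcal{I}=(I_T,I_F)$ and $\mathcal{I}'=(I_T',I_F')$ be 3-valued interpretations for $\mathcal{K}$ with $\mathcal{I}\le\mathcal{I}'$. Then for every $Tr\subseteq\mathrm{KA}(\mathcal{K})$, $\mathit{OpTrue}^{\mathcal{K}}_{\mathcal{I}}(Tr)\subseteq\mathit{OpTrue}^{\mathcal{K}}_{\mathcal{I}'}(Tr)$, and for every $Fa\subseteq\mathrm{KA}(\mathcal{K})$, $\mathit{OpFalse}^{\mathcal{K}}_{\mathcal{I}}(Fa)\subseteq\mathit{OpFalse}^{\mathcal{K}}_{\mathcal{I}'}(Fa)$.
   Context: A hybrid knowledge base with function symbols is a pair $\mathcal{K}=(\mathcal{O},\mathcal{P})$ where $\mathcal{O}$ is a finite set of description logic axioms translated to a first-order theory $\pi(\mathcal{O})$ by the standard translation, and $\mathcal{P}$ is a finite set of normal rules $h\leftarrow a_1,\dots,a_n,\mathit{not}\,b_1,\dots,\mathit{not}\,b_m$ whose atoms may contain function symbols. An atom is a DL-atom if its predicate occurs in $\mathcal{O}$; $\mathcal{K}$ is DL-safe if in every rule each variable occurs in some positive non-DL-atom of the body. $\mathcal{P}_g$ is the grounding of $\mathcal{P}$ (all ground instances over terms built from the constants and function symbols of $\mathcal{K}$); $\mathrm{KA}(\mathcal{K})$ is the set of ground atoms occurring in $\mathcal{P}_g$. For $S\subseteq\mathrm{KA}(\mathcal{K})$, $\mathrm{OB}_{\mathcal{K}}(S)=\{\pi(\mathcal{O})\}\cup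 S$; $\models$ is first-order entailment. A 3-valued interpretation is a pair $(I_T,I_F)$ of disjoint subsets of $\mathrm{KA}(\mathcal{K})$; an atom is true in it if in $I_T$, false if in $I_F$; $(I_T,I_F)\le(I_T',I_F')$ iff $I_T\subseteq I_T'$ and $I_F\subseteq I_F'$. $\mathit{OpTrue}^{\mathcal{K}}_{\mathcal{I}}(Tr)=\{a\in\mathrm{KA}(\mathcal{K}) : $ there is a rule $a\leftarrow a_1,\dots,a_n,\mathit{not}\,b_1,\dots,\mathit{not}\,b_r$ in $\mathcal{P}_g$ with each $a_i$ true in $\mathcal{I}$ or $a_i\in Tr$, and each $b_j$ false in $\mathcal{I}\}\cup\{a\in\mathrm{KA}(\mathcal{K}) : \mathrm{OB}_{\mathcal{K}}(I_T\cup Tr)\models a\}$. $\mathit{OpFalse}^{\mathcal{K}}_{\mathcal{I}}(Fa)=\{a\in\mathrm{KA}(\mathcal{K}) : \mathrm{OB}_{\mathcal{K}}(I_T)\models\neg a$, or for every rule $a\leftarrow a_1,\dots,a_n,\mathit{not}\,b_1,\dots,\mathit{not}\,b_r$ in $\mathcal{P}_g$ some $a_i$ is false in $\mathcal{I}$ or in $Fa$, or some $b_j$ is true in $\mathcal{I}\}\cap\{a\in\mathrm{KA}(\mathcal{K}) : \mathrm{OB}_{\mathcal{K}}(\mathrm{KA}(\mathcal{K})\setminus(I_F\cup Fa))\not\models a\}$. -}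

module Defs where

open import Level using (Level; 0ℓ) renaming (suc to lsuc)
open import Data.Nat using (ℕ; _≡ᵇ_)
open import Data.Bool using (Bool; true; false; if_then_else_; T)
open import Data.List using (List; []; _∷_; length)
open import Data.List.Membership.Propositional using (_∈_)
open import Data.List.Relation.Unary.All using (All)
open import Data.List.Relation.Unary.Any using (Any)
open import Data.Product using (Σ; _×_; _,_; ∃)
open import Data.Sum using (_⊎_)
open import Data.Empty using (⊥)
open import Relation.Nullary using (¬_)
open import Relation.Binary.PropositionalEquality using (_≡_)

-- Function symbols (constants = 0-ary function
-- symbols), predicate symbols and variables are named by natural numbers.
-- A symbol is identified by its name together with its arity.

data Term : Set where
  var : ℕ → Term
  fn  : ℕ → List Term → Term

record Atom : Set where
  constructor _⟨_⟩
  field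
    pred : ℕ
    args : List Term
open Atom public

infixr 6 _∧f_
infixr 5 _∨f_
infixr 4 _⇒f_

data Formula : Set where
  atom  : Atom → Formula
  _≐_   : Term → Term → Formula
  ⊥f    : Formula
  ¬f_   : Formula → Formula
  _∧f_  : Formula → Formula → Formula
  _∨f_  : Formula → Formula → Formula
  _⇒f_  : Formula → Formula → Formula
  ∀f    : ℕ → Formula → Formula
  ∃f    : ℕ → Formula → Formula

mutual
  data GroundT : Term → Set where
    fn : ∀ {f ts} → GroundTs ts → GroundT (fn f ts)

  data GroundTs : List Term → Set where
    []  : GroundTs []
    _∷_ : ∀ {t ts} → GroundT t → GroundTs ts → GroundTs (t ∷ ts)

GroundA : Atom → Set
GroundA a = GroundTs (args a)

mutual
  data FunInT (f n : ℕ) : Term → Set where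
    here  : ∀ {ts} → length ts ≡ n → FunInT f n (fn f ts)
    there : ∀ {g ts} → FunInTs f n ts → FunInT f n (fn g ts)

  data FunInTs (f n : ℕ) : List Term → Set where
    here  : ∀ {t ts} → FunInT f n t → FunInTs f n (t ∷ ts)
    there : ∀ {t ts} → FunInTs f n ts → FunInTs f n (t ∷ ts)

mutual
  data VarInT (x : ℕ) : Term → Set where
    here  : VarInT x (var x)
    there : ∀ {g ts} → VarInTs x ts → VarInT x (fn g ts)

  data VarInTs (x : ℕ) : List Term → Set where
    here  : ∀ {t ts} → VarInT x t → VarInTs x (t ∷ ts)
    there : ∀ {t ts} → VarInTs x ts → VarInTs x (t ∷ ts)

FunInA : ℕ → ℕ → Atom → Set
FunInA f n a = FunInTs f n (args a)

VarInA : ℕ → Atom → Set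
VarInA x a = VarInTs x (args a)

data FunInF (f n : ℕ) : Formula → Set where
  atom : ∀ {a} → FunInA f n a → FunInF f n (atom a)
  eqˡ  : ∀ {s t} → FunInT f n s → FunInF f n (s ≐ t)
  eqʳ  : ∀ {s t} → FunInT f n t → FunInF f n (s ≐ t)
  negF : ∀ {φ} → FunInF f n φ → FunInF f n (¬f φ)
  andˡ : ∀ {φ ψ} → FunInF f n φ → FunInF f n (φ ∧f ψ)
  andʳ : ∀ {φ ψ} → FunInF f n ψ → FunInF f n (φ ∧f ψ)
  orˡ  : ∀ {φ ψ} → FunInF f n φ → FunInF f n (φ ∨f ψ)
  orʳ  : ∀ {φ ψ} → FunInF f n ψ → FunInF f n (φ ∨f ψ)
  impˡ : ∀ {φ ψ} → FunInF f n φ → FunInF f n (φ ⇒f ψ)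
  impʳ : ∀ {φ ψ} → FunInF f n ψ → FunInF f n (φ ⇒f ψ)
  all  : ∀ {x φ} → FunInF f n φ → FunInF f n (∀f x φ)
  ex   : ∀ {x φ} → FunInF f n φ → FunInF f n (∃f x φ)

data PredInF (p n : ℕ) : Formula → Set where
  atom : ∀ {ts} → length ts ≡ n → PredInF p n (atom (p ⟨ ts ⟩))
  negF : ∀ {φ} → PredInF p n φ → PredInF p n (¬f φ)
  andˡ : ∀ {φ ψ} → PredInF p n φ → PredInF p n (φ ∧f ψ)
  andʳ : ∀ {φ ψ} → PredInF p n ψ → PredInF p n (φ ∧f ψ)
  orˡ  : ∀ {φ ψ} → PredInF p n φ → PredInF p n (φ ∨f ψ)
  orʳ  : ∀ {φ ψ} → PredInF p n ψ → PredInF p n (φ ∨f ψ)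
  impˡ : ∀ {φ ψ} → PredInF p n φ → PredInF p n (φ ⇒f ψ)
  impʳ : ∀ {φ ψ} → PredInF p n ψ → PredInF p n (φ ⇒f ψ)
  all  : ∀ {x φ} → PredInF p n φ → PredInF p n (∀f x φ)
  ex   : ∀ {x φ} → PredInF p n φ → PredInF p n (∃f x φ)

mutual
  substT : (ℕ → Term) → Term → Term
  substT σ (var x)   = σ x
  substT σ (fn f ts) = fn f (substTs σ ts)

  substTs : (ℕ → Term) → List Term → List Term
  substTs σ []       = []
  substTs σ (t ∷ ts) = substT σ t ∷ substTs σ ts

substA : (ℕ → Term) → Atom → Atom
substA σ (p ⟨ ts ⟩) = p ⟨ substTs σ ts ⟩

substAs : (ℕ → Term) → List Atom → List Atom
substAs σ []       = []
substAs σ (a ∷ as) = substA σ a ∷ substAs σ as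

record Rule : Set where
  constructor rule
  field
    head : Atom
    pos  : List Atom
    neg  : List Atom
open Rule public

substR : (ℕ → Term) → Rule → Rule
substR σ (rule h ps ns) = rule (substA σ h) (substAs σ ps) (substAs σ ns)

AtomInR : Atom → Rule → Set
AtomInR a r = a ≡ head r ⊎ a ∈ pos r ⊎ a ∈ neg r

-- Hybrid knowledge base K = (O , P).
-- O is given through its standard first-order translation π(O), a finite
-- list of first-order sentences; P is a finite list of normal rules.

record KB : Set where
  constructor ⟨_,_⟩
  field
    πO : List Formula
    P  : List Rule
open KB public

FunInK : KB → ℕ → ℕ → Set
FunInK K f n =
  (Σ Formula λ φ → φ ∈ πO K × FunInF f n φ)
  ⊎ (Σ Rule λ r → r ∈ P K × Σ Atom λ a → AtomInR a r × FunInA f n a)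

DLAtom : KB → Atom → Set
DLAtom K a = Σ Formula λ φ → φ ∈ πO K × PredInF (pred a) (length (args a)) φ

DLSafe : KB → Set
DLSafe K = ∀ r → r ∈ P K → ∀ x → (Σ Atom λ a → AtomInR a r × VarInA x a) →
  Σ Atom λ b → b ∈ pos r × ¬ DLAtom K b × VarInA x b

Pg : KB → Rule → Set
Pg K r' = Σ Rule λ r → r ∈ P K × Σ (ℕ → Term) λ σ → r' ≡ substR σ r
  × (∀ a → AtomInR a r' → GroundA a × (∀ f n → FunInA f n a → FunInK K f n))

KA : KB → Atom → Set
KA K a = Σ Rule λ r → Pg K r × AtomInR a r

-- Semantics: first-order structures and (classical) entailment.
-- Classical connectives are rendered via the double-negation reading so
-- that satisfaction is classical (¬¬-stable).

record Structure : Set₁ where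
  field
    D    : Set
    d₀   : D                    -- domains are non-empty
    fun  : ℕ → List D → D
    rel  : ℕ → List D → Bool
open Structure public

module _ (M : Structure) where
  mutual
    evalT : (ℕ → D M) → Term → D M
    evalT ρ (var x)   = ρ x
    evalT ρ (fn f ts) = fun M f (evalTs ρ ts)

    evalTs : (ℕ → D M) → List Term → List (D M)
    evalTs ρ []       = []
    evalTs ρ (t ∷ ts) = evalT ρ t ∷ evalTs ρ ts

  update : (ℕ → D M) → ℕ → D M → (ℕ → D M)
  update ρ x d y = if x ≡ᵇ y then d else ρ y

  Sat : (ℕ → D M) → Formula → Set
  Sat ρ (atom (p ⟨ ts ⟩)) = T (rel M p (evalTs ρ ts))
  Sat ρ (s ≐ t)  = ¬ ¬ (evalT ρ s ≡ evalT ρ t)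
  Sat ρ ⊥f       = ⊥
  Sat ρ (¬f φ)   = ¬ Sat ρ φ
  Sat ρ (φ ∧f ψ) = Sat ρ φ × Sat ρ ψ
  Sat ρ (φ ∨f ψ) = ¬ (¬ Sat ρ φ × ¬ Sat ρ ψ)
  Sat ρ (φ ⇒f ψ) = Sat ρ φ → Sat ρ ψ
  Sat ρ (∀f x φ) = (d : D M) → Sat (update ρ x d) φ
  Sat ρ (∃f x φ) = ¬ ((d : D M) → ¬ Sat (update ρ x d) φ)

Theory : Set₁
Theory = Formula → Set

infix 3 _⊨_
_⊨_ : Theory → Formula → Set₁
Γ ⊨ φ = (M : Structure) (ρ : ℕ → D M) → (∀ ψ → Γ ψ → Sat M ρ ψ) → Sat M ρ φ

OB : KB → (Atom → Set) → Theory
OB K S φ = φ ∈ πO K ⊎ (Σ Atom λ a → S a × φ ≡ atom a)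

record Interp (K : KB) : Set₁ where
  field
    IT IF    : Atom → Set
    IT⊆KA    : ∀ a → IT a → KA K a
    IF⊆KA    : ∀ a → IF a → KA K a
    disjoint : ∀ a → IT a → IF a → ⊥
open Interp public

_≤I_ : {K : KB} → Interp K → Interp K → Set
I ≤I I' = (∀ a → IT I a → IT I' a) × (∀ a → IF I a → IF I' a)

OpTrue : (K : KB) → Interp K → (Atom → Set) → Atom → Set₁
OpTrue K I Tr a = KA K a ×
  ( (Σ Rule λ r → Pg K r × head r ≡ a
       × All (λ b → IT I b ⊎ Tr b) (pos r) × All (IF I) (neg r))
  ⊎ (OB K (λ b → IT I b ⊎ Tr b) ⊨ atom a) )

OpFalse : (K : KB) → Interp K → (Atom → Set) → Atom → Set₁
OpFalse K I Fa a = KA K a ×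
  ( ( (OB K (IT I) ⊨ ¬f atom a)
    ⊎ (∀ r → Pg K r → head r ≡ a →
         Any (λ b → IF I b ⊎ Fa b) (pos r) ⊎ Any (IT I) (neg r)) )
  × ¬ (OB K (λ b → KA K b × ¬ (IF I b ⊎ Fa b)) ⊨ atom a) )

{-# OPTIONS --safe #-}
module Submission where

-- I_T and I_F occur only positively in both operators, except in the consistency
-- condition of OpFalse, where I_F sits in the negated part of a theory that is
-- itself under a negation. Entailment is monotone in the theory, so enlarging the
-- interpretation can only make each condition easier to meet.

open import Defs
open import Data.Product using (_×_; _,_; proj₁; proj₂; map₂)
open import Data.Sum using (_⊎_; inj₁; inj₂; map₁) renaming (map to ⊎-map)
open import Data.List.Relation.Unary.All as All using ()
open import Data.List.Relation.Unary.Any as Any using ()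
open import Function using (_∘_)
open import Relation.Binary.PropositionalEquality using (_≡_)
open import Relation.Unary using (_⊆_; _∪_)

⊨-mono : {Γ Γ' : Theory} {φ : Formula} → Γ ⊆ Γ' → Γ ⊨ φ → Γ' ⊨ φ
⊨-mono Γ⊆Γ' Γ⊨φ M ρ sat = Γ⊨φ M ρ (λ ψ ψ∈Γ → sat ψ (Γ⊆Γ' ψ∈Γ))

OB-mono : (K : KB) {S S' : Atom → Set} → S ⊆ S' → OB K S ⊆ OB K S'
OB-mono K S⊆S' (inj₁ φ∈πO)         = inj₁ φ∈πO
OB-mono K S⊆S' (inj₂ (a , a∈S , eq)) = inj₂ (a , S⊆S' a∈S , eq)

module _ {K : KB} (I I' : Interp K) (I≤I' : I ≤I I') where

  private
    IT⊆IT' : IT I ⊆ IT I'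
    IT⊆IT' = proj₁ I≤I' _

    IF⊆IF' : IF I ⊆ IF I'
    IF⊆IF' = proj₂ I≤I' _

  OpTrue-mono : (Tr : Atom → Set) (a : Atom) → OpTrue K I Tr a → OpTrue K I' Tr a
  OpTrue-mono Tr a (a∈KA , inj₁ (r , r∈Pg , head≡a , pos-true , neg-false)) =
    a∈KA , inj₁ (r , r∈Pg , head≡a , All.map (map₁ IT⊆IT') pos-true , All.map IF⊆IF' neg-false)
  OpTrue-mono Tr a (a∈KA , inj₂ entailed) =
    a∈KA , inj₂ (⊨-mono (OB-mono K (map₁ IT⊆IT')) entailed)

  OpFalse-mono : (Fa : Atom → Set) (a : Atom) → OpFalse K I Fa a → OpFalse K I' Fa a
  OpFalse-mono Fa a (a∈KA , unsupported , not-entailed) =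
    a∈KA , ⊎-map (⊨-mono {φ = ¬f atom a} (OB-mono K IT⊆IT')) every-rule-blocked unsupported
         , not-entailed ∘ ⊨-mono (OB-mono K (map₂ (_∘ map₁ IF⊆IF')))
    where
    every-rule-blocked :
      (∀ r → Pg K r → head r ≡ a → Any.Any (IF I ∪ Fa) (pos r) ⊎ Any.Any (IT I) (neg r)) →
      (∀ r → Pg K r → head r ≡ a → Any.Any (IF I' ∪ Fa) (pos r) ⊎ Any.Any (IT I') (neg r))
    every-rule-blocked blocked r r∈Pg head≡a =
      ⊎-map (Any.map (map₁ IF⊆IF')) (Any.map IT⊆IT') (blocked r r∈Pg head≡a)

proposition2 : (K : KB) → DLSafe K → (I I' : Interp K) → I ≤I I' →
    ((Tr : Atom → Set) → (∀ a → Tr a → KA K a) →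
       ∀ a → OpTrue K I Tr a → OpTrue K I' Tr a)
    × ((Fa : Atom → Set) → (∀ a → Fa a → KA K a) →
       ∀ a → OpFalse K I Fa a → OpFalse K I' Fa a)
proposition2 K _ I I' I≤I' =
  (λ Tr _ → OpTrue-mono I I' I≤I' Tr) , (λ Fa _ → OpFalse-mono I I' I≤I' Fa)
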